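{- For every positive integer $k$ and every finite simple graph $G$, both of the following hold: (i) either $G$ contains no induced path on $k$ vertices, or $G$ contains an induced path on $k$ vertices that is avoidable in $G$; (ii) for every vertex $u \in V(G)$, either $G - N[u]$ contains no induced path on $k$ vertices, or there is an induced path on $k$ vertices with all its vertices in $V(G)\setminus N[u]$ that is avoidable in $G$.
   Context: Graphs are finite, simple and loopless. $N[u]$ denotes the closed neighbourhood of $u$ and $G - Y$ the subgraph induced by $V(G)\setminus Y$. Given an induced path $P$ in $G$, an extension of $P$ is an induced path $xPy$ in $G$ (adding a vertex $x$ adjacent to one endpoint and a vertex $y$ adjacent to the other, the result being an induced path). An induced path $P$ is failing if no induced cycle of $G$ contains $P$. A path $P$ is avoidable in $G$ if it is induced and has no failing extension in $G$ (avoidability is always with respect to the whole graph $G$). -}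

module Defs where

open import Level using (0ℓ)
open import Data.Nat using (ℕ; suc)
open import Data.Fin using (Fin; toℕ)
open import Data.Vec using (Vec; lookup; _∷_; _∷ʳ_)
open import Data.Product using (Σ; _×_; ∃)
open import Data.Sum using (_⊎_)
open import Relation.Binary using (Rel; Decidable; Symmetric; Irreflexive)
open import Relation.Binary.PropositionalEquality using (_≡_; _≢_)
open import Relation.Nullary using (¬_)
open import Data.Vec.Membership.Propositional using (_∈_)

record Graph : Set₁ where
  field
    n      : ℕ
    _~_    : Rel (Fin n) 0ℓ
    ~-dec  : Decidable _~_
    ~-sym  : Symmetric _~_
    ~-irr  : Irreflexive _≡_ _~_

  Vertex : Set
  Vertex = Fin n

  PathAdj : {k : ℕ} → Fin k → Fin k → Set
  PathAdj i j = suc (toℕ i) ≡ toℕ j ⊎ suc (toℕ j) ≡ toℕ i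

  CycAdj : {m : ℕ} → Fin m → Fin m → Set
  CycAdj {m} i j = PathAdj i j
                 ⊎ (suc (toℕ i) ≡ m × toℕ j ≡ 0)
                 ⊎ (suc (toℕ j) ≡ m × toℕ i ≡ 0)

  record InducedPath {k : ℕ} (P : Vec Vertex k) : Set where
    field
      distinct : ∀ i j → lookup P i ≡ lookup P j → i ≡ j
      adj⇒pos  : ∀ i j → lookup P i ~ lookup P j → PathAdj i j
      pos⇒adj  : ∀ i j → PathAdj i j → lookup P i ~ lookup P j

  record InducedCycle {m : ℕ} (C : Vec Vertex m) : Set where
    field
      length≥3 : 3 Data.Nat.≤ m
      distinct : ∀ i j → lookup C i ≡ lookup C j → i ≡ j
      adj⇒pos  : ∀ i j → lookup C i ~ lookup C j → CycAdj i j
      pos⇒adj  : ∀ i j → CycAdj i j → lookup C i ~ lookup C j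

  -- the induced cycle C contains the induced path P (as a subgraph; since C is
  -- induced and P is a path of G this amounts to V(P) ⊆ V(C))
  CycleContains : {m k : ℕ} → Vec Vertex m → Vec Vertex k → Set
  CycleContains C P = ∀ i → lookup P i ∈ C

  Failing : {k : ℕ} → Vec Vertex k → Set
  Failing P = ¬ (Σ ℕ λ m → Σ (Vec Vertex m) λ C → InducedCycle C × CycleContains C P)

  Avoidable : {k : ℕ} → Vec Vertex k → Set
  Avoidable P = InducedPath P
              × (∀ x y → InducedPath (x ∷ (P ∷ʳ y)) → ¬ Failing (x ∷ (P ∷ʳ y)))

  OutsideClosedNbhd : {k : ℕ} → Vertex → Vec Vertex k → Set
  OutsideClosedNbhd u P = ∀ i → lookup P i ≢ u × ¬ (u ~ lookup P i)

module Submission where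

open import Defs
open import Data.Nat using (ℕ; zero; suc; _+_; _≤_; _<_; z≤n; s≤s)
import Data.Nat.Properties as ℕ
open import Data.Fin using (Fin; zero; suc; toℕ; inject₁; fromℕ)
import Data.Fin.Properties as Fin
open import Data.Fin.Properties
  using (fromℕ≢inject₁; toℕ-inject₁-≢; inject₁-injective; toℕ-inject₁; toℕ-fromℕ; toℕ<n; suc-injective)
open import Data.Fin.Subset using (Subset; ⊤; outside; _∈_; _∉_; _⊆_; _∪_; _─_; ⁅_⁆; ∣_∣)
open import Data.Fin.Subset.Properties
  using (_∈?_; ∈⊤; p⊆p∪q; x∈p∪q⁺; x∈p∪q⁻; x∈⁅x⁆; x∈⁅y⁆⇒x≡y; x∈p∩q⁺; x∈p∧x∉q⇒x∈p─q; p─q⊆p;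
         p─q─r≡p─q∪r; p∩q≢∅⇒∣p─q∣<∣p∣; p⊆q⇒∣p∣≤∣q∣)
open import Data.Vec using (Vec; []; _∷_; lookup; _∷ʳ_; _++_; initLast; tabulate; here; there)
open import Data.Vec.Properties using (lookup∘tabulate; lookup⇒[]=; []=⇒lookup)
open import Data.Vec.Relation.Unary.Any using (here; there)
open import Data.Vec.Membership.Propositional using () renaming (_∈_ to _∈ᵥ_)
open import Data.List using (List; []; _∷_)
open import Data.List.Relation.Unary.Any using (Any; here; there; any?)
open import Data.List.Membership.Propositional using (lose) renaming (_∈_ to _∈ˡ_; _∉_ to _∉ˡ_)
open import Data.Bool.Properties using (T-≡)
open import Data.Product using (Σ; _×_; _,_; proj₁; proj₂)
open import Data.Sum using (_⊎_; inj₁; inj₂; [_,_])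
open import Data.Empty using (⊥-elim)
open import Function using (_∘_; Equivalence)
open import Relation.Nullary using (¬_; Dec; yes; no)
open import Relation.Nullary.Decidable
  using (isYes; toWitness; fromWitness; map′; ¬?; _×-dec_; _⊎-dec_; _→-dec_)
open import Relation.Binary.PropositionalEquality using (_≡_; _≢_; refl; sym; trans; cong; subst)

-- The proof is the relative version of the statement, by joint induction on a measure of (S, A):
--   (1) if G[S] has an induced k-path, it has one avoidable in G[S];
--   (2) if A ⊆ S is non-empty and connected and some induced k-path of G[S] avoids N[A], then
--       some induced k-path of G[S] avoiding N[A] is avoidable in G[S].
-- For (1), an extension x P y in S leaves P minus its first vertex, plus y, outside N[x]: use (2)
-- with A = {x}.  For (2), grow A by a neighbour whenever a k-path avoiding the larger closed
-- neighbourhood remains; otherwise apply (1) to S ∖ N[A] and lift: an extension x P y in S with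
-- one end near A would have let A grow, one with no end near A lives in S ∖ N[A], and one with
-- both ends near A closes into an induced cycle through a shortest path inside A.
-- The theorem is (1) and (2) for S = V(G), A = {u}.

module PathAlgebra (G : Graph) where
  open Graph G

  ~-resp : ∀ {a b c d} → a ≡ b → c ≡ d → a ~ c → b ~ d
  ~-resp refl refl a~c = a~c

  lookup-∷ʳ-inject₁ : ∀ {m} (L : Vec Vertex m) y i → lookup (L ∷ʳ y) (inject₁ i) ≡ lookup L i
  lookup-∷ʳ-inject₁ (a ∷ L) y zero    = refl
  lookup-∷ʳ-inject₁ (a ∷ L) y (suc i) = lookup-∷ʳ-inject₁ L y i

  lookup-∷ʳ-last : ∀ {m} (L : Vec Vertex m) y → lookup (L ∷ʳ y) (fromℕ m) ≡ y
  lookup-∷ʳ-last []      y = refl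
  lookup-∷ʳ-last (a ∷ L) y = lookup-∷ʳ-last L y

  Every : (Vertex → Set) → ∀ {m} → Vec Vertex m → Set
  Every Q L = ∀ i → Q (lookup L i)

  module _ {Q : Vertex → Set} where

    every-∷ : ∀ {m a} {L : Vec Vertex m} → Q a → Every Q L → Every Q (a ∷ L)
    every-∷ qa qL zero    = qa
    every-∷ qa qL (suc i) = qL i

    every-∷ʳ : ∀ {m y} (L : Vec Vertex m) → Every Q L → Q y → Every Q (L ∷ʳ y)
    every-∷ʳ []      qL qy zero    = qy
    every-∷ʳ (a ∷ L) qL qy zero    = qL zero
    every-∷ʳ (a ∷ L) qL qy (suc i) = every-∷ʳ L (λ j → qL (suc j)) qy i

    every-init : ∀ {m a} (L : Vec Vertex m) → Every Q (L ∷ʳ a) → Every Q L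
    every-init {a = a} L q i = subst Q (lookup-∷ʳ-inject₁ L a i) (q (inject₁ i))

    every-++ : ∀ {m m'} (L : Vec Vertex m) {L' : Vec Vertex m'}
             → Every Q L → Every Q L' → Every Q (L ++ L')
    every-++ []      qL qL' i       = qL' i
    every-++ (a ∷ L) qL qL' zero    = qL zero
    every-++ (a ∷ L) qL qL' (suc i) = every-++ L (λ j → qL (suc j)) qL' i

  Apart : Vertex → Vertex → Set
  Apart u v = u ≢ v × ¬ u ~ v

  Far : Vertex → ∀ {m} → Vec Vertex m → Set
  Far w = Every (Apart w)

  Separated : ∀ {k m} → Vec Vertex k → Vec Vertex m → Set
  Separated P Z = Every (λ p → Far p Z) P

  record Attaches {m} (w : Vertex) (L : Vec Vertex m) (E : Fin m → Set) : Set where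
    field
      fresh : ∀ j → w ≢ lookup L j
      adj⇒  : ∀ j → w ~ lookup L j → E j
      ⇒adj  : ∀ j → E j → w ~ lookup L j

  AtStart AtEnd AtEnds : ∀ {m} → Fin m → Set
  AtStart j       = toℕ j ≡ 0
  AtEnd {m} j     = suc (toℕ j) ≡ m
  AtEnds j        = AtStart j ⊎ AtEnd j

  []-induced : InducedPath []
  []-induced = record { distinct = λ () ; adj⇒pos = λ () ; pos⇒adj = λ () }

  ∷-induced : ∀ {m a} {L : Vec Vertex m} → InducedPath L → Attaches a L AtStart → InducedPath (a ∷ L)
  ∷-induced {a = a} {L} ip att = record { distinct = dis ; adj⇒pos = ap ; pos⇒adj = pa }
    where
      module I = InducedPath ip
      module W = Attaches att
      dis : ∀ i j → lookup (a ∷ L) i ≡ lookup (a ∷ L) j → i ≡ j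
      dis zero    zero    e = refl
      dis zero    (suc j) e = ⊥-elim (W.fresh j e)
      dis (suc i) zero    e = ⊥-elim (W.fresh i (sym e))
      dis (suc i) (suc j) e = cong suc (I.distinct i j e)
      ap : ∀ i j → lookup (a ∷ L) i ~ lookup (a ∷ L) j → PathAdj i j
      ap zero    zero    e = ⊥-elim (~-irr refl e)
      ap zero    (suc j) e = inj₁ (cong suc (sym (W.adj⇒ j e)))
      ap (suc i) zero    e = inj₂ (cong suc (sym (W.adj⇒ i (~-sym e))))
      ap (suc i) (suc j) e with I.adj⇒pos i j e
      ... | inj₁ q = inj₁ (cong suc q)
      ... | inj₂ q = inj₂ (cong suc q)
      pa : ∀ i j → PathAdj i j → lookup (a ∷ L) i ~ lookup (a ∷ L) j
      pa zero    zero    (inj₁ ())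
      pa zero    zero    (inj₂ ())
      pa zero    (suc j) (inj₁ q) = W.⇒adj j (sym (ℕ.suc-injective q))
      pa zero    (suc j) (inj₂ ())
      pa (suc i) zero    (inj₁ ())
      pa (suc i) zero    (inj₂ q) = ~-sym (W.⇒adj i (sym (ℕ.suc-injective q)))
      pa (suc i) (suc j) (inj₁ q) = I.pos⇒adj i j (inj₁ (ℕ.suc-injective q))
      pa (suc i) (suc j) (inj₂ q) = I.pos⇒adj i j (inj₂ (ℕ.suc-injective q))

  ∷-induced⁻ : ∀ {m a} {L : Vec Vertex m} → InducedPath (a ∷ L) → InducedPath L × Attaches a L AtStart
  ∷-induced⁻ {m} ip =
      record { distinct = λ i j e → suc-injective (I.distinct (suc i) (suc j) e)
             ; adj⇒pos  = λ i j e → shift⁻ (I.adj⇒pos (suc i) (suc j) e)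
             ; pos⇒adj  = λ i j p → I.pos⇒adj (suc i) (suc j) (shift p) }
    , record { fresh = λ j e → zero≢suc (I.distinct zero (suc j) e)
             ; adj⇒  = λ j e → atStart (I.adj⇒pos zero (suc j) e)
             ; ⇒adj  = λ j z → I.pos⇒adj zero (suc j) (inj₁ (cong suc (sym z))) }
    where
      module I = InducedPath ip
      zero≢suc : ∀ {j : Fin m} → zero ≢ suc j
      zero≢suc ()
      shift : ∀ {i j : Fin m} → PathAdj i j → PathAdj (suc i) (suc j)
      shift (inj₁ q) = inj₁ (cong suc q)
      shift (inj₂ q) = inj₂ (cong suc q)
      shift⁻ : ∀ {i j : Fin m} → PathAdj (suc i) (suc j) → PathAdj i j
      shift⁻ (inj₁ q) = inj₁ (ℕ.suc-injective q)
      shift⁻ (inj₂ q) = inj₂ (ℕ.suc-injective q)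
      atStart : ∀ {j : Fin m} → PathAdj zero (suc j) → toℕ j ≡ 0
      atStart (inj₁ q) = sym (ℕ.suc-injective q)
      atStart (inj₂ ())

  attaches-tail : ∀ {m w a} {L : Vec Vertex m} → Attaches w (a ∷ L) AtStart → Far w L
  attaches-tail att j = fresh (suc j) , λ w~ → ℕ.1+n≢0 (adj⇒ (suc j) w~)
    where open Attaches att

  init-induced : ∀ {m y} (L : Vec Vertex m) → InducedPath (L ∷ʳ y) → InducedPath L
  init-induced {y = y} L ip = record { distinct = dis ; adj⇒pos = ap ; pos⇒adj = pa }
    where
      module I = InducedPath ip
      at : ∀ i → lookup (L ∷ʳ y) (inject₁ i) ≡ lookup L i
      at = lookup-∷ʳ-inject₁ L y
      -- consecutiveness only depends on the numeric positions, which inject₁ preserves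
      consecutive : ∀ {a b c d} → a ≡ b → c ≡ d → suc a ≡ c ⊎ suc c ≡ a → suc b ≡ d ⊎ suc d ≡ b
      consecutive refl refl p = p
      dis : ∀ i j → lookup L i ≡ lookup L j → i ≡ j
      dis i j e =
        inject₁-injective (I.distinct (inject₁ i) (inject₁ j) (trans (at i) (trans e (sym (at j)))))
      ap : ∀ i j → lookup L i ~ lookup L j → PathAdj i j
      ap i j e = consecutive (toℕ-inject₁ i) (toℕ-inject₁ j)
                   (I.adj⇒pos (inject₁ i) (inject₁ j) (~-resp (sym (at i)) (sym (at j)) e))
      pa : ∀ i j → PathAdj i j → lookup L i ~ lookup L j
      pa i j p = ~-resp (at i) (at j) (I.pos⇒adj (inject₁ i) (inject₁ j)
                   (consecutive (sym (toℕ-inject₁ i)) (sym (toℕ-inject₁ j)) p))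

  ∷ʳ-induced⁻ : ∀ {m y} {L : Vec Vertex m} → InducedPath (L ∷ʳ y) → InducedPath L × Attaches y L AtEnd
  ∷ʳ-induced⁻ {m} {y} {L} ip =
      init-induced L ip
    , record { fresh = fresh ; adj⇒ = adj⇒ ; ⇒adj = ⇒adj }
    where
      module I = InducedPath ip
      at : ∀ j → lookup (L ∷ʳ y) (inject₁ j) ≡ lookup L j
      at = lookup-∷ʳ-inject₁ L y
      fresh : ∀ j → y ≢ lookup L j
      fresh j e = fromℕ≢inject₁ (I.distinct (fromℕ m) (inject₁ j)
                    (trans (lookup-∷ʳ-last L y) (trans e (sym (at j)))))
      adj⇒ : ∀ j → y ~ lookup L j → suc (toℕ j) ≡ m
      adj⇒ j e with I.adj⇒pos (inject₁ j) (fromℕ m)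
                      (~-resp (sym (at j)) (sym (lookup-∷ʳ-last L y)) (~-sym e))
      ... | inj₁ q = trans (cong suc (sym (toℕ-inject₁ j))) (trans q (toℕ-fromℕ m))
      ... | inj₂ q = ⊥-elim (ℕ.<⇒≱ (toℕ<n j) (ℕ.≤-trans (ℕ.n≤1+n m)
                       (ℕ.≤-reflexive (trans (cong suc (sym (toℕ-fromℕ m))) (trans q (toℕ-inject₁ j))))))
      ⇒adj : ∀ j → suc (toℕ j) ≡ m → y ~ lookup L j
      ⇒adj j q = ~-sym (~-resp (at j) (lookup-∷ʳ-last L y) (I.pos⇒adj (inject₁ j) (fromℕ m)
                   (inj₁ (trans (cong suc (toℕ-inject₁ j)) (trans q (sym (toℕ-fromℕ m)))))))

  attaches-init : ∀ {m w a} (L : Vec Vertex m) → Attaches w (L ∷ʳ a) AtEnd → Far w L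
  attaches-init {a = a} L att j =
      (λ e → fresh (inject₁ j) (trans e (sym (lookup-∷ʳ-inject₁ L a j))))
    , (λ w~ → toℕ-inject₁-≢ j (sym (ℕ.suc-injective
                 (adj⇒ (inject₁ j) (~-resp refl (sym (lookup-∷ʳ-inject₁ L a j)) w~)))))
    where open Attaches att

  extension-ends-apart : ∀ {k x y} {P : Vec Vertex (suc k)} → InducedPath (x ∷ (P ∷ʳ y)) → Apart x y
  extension-ends-apart {x = x} {P = P} ip =
      (λ e → fresh zero (sym e))
    , (λ x~y → ℕ.1+n≢0 (sym (ℕ.suc-injective (adj⇒ zero (~-sym x~y)))))
    where open Attaches (proj₂ (∷ʳ-induced⁻ {L = x ∷ P} ip))

  drop-first : ∀ {k x p y} {P₁ : Vec Vertex k} → InducedPath (x ∷ ((p ∷ P₁) ∷ʳ y))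
             → InducedPath (P₁ ∷ʳ y) × Far x (P₁ ∷ʳ y)
  drop-first ext = proj₁ (∷-induced⁻ (proj₁ (∷-induced⁻ ext))) , attaches-tail (proj₂ (∷-induced⁻ ext))

  drop-last : ∀ {k x p y} {P₀ : Vec Vertex k} → InducedPath (x ∷ ((P₀ ∷ʳ p) ∷ʳ y))
            → InducedPath (x ∷ P₀) × Far y (x ∷ P₀)
  drop-last {x = x} {p} {P₀ = P₀} ext =
    proj₁ (∷ʳ-induced⁻ {L = x ∷ P₀} (proj₁ xPp)) , attaches-init (x ∷ P₀) (proj₂ xPp)
    where xPp = ∷ʳ-induced⁻ {L = x ∷ (P₀ ∷ʳ p)} ext

  ++-position : ∀ {k m} (P : Vec Vertex k) (y : Vertex) (Z : Vec Vertex m) (j : Fin (k + suc m))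
    → (Σ (Fin (suc k)) λ i → toℕ i ≡ toℕ j × lookup (P ++ (y ∷ Z)) j ≡ lookup (P ∷ʳ y) i)
    ⊎ (Σ (Fin m) λ i → toℕ j ≡ suc (k + toℕ i) × lookup (P ++ (y ∷ Z)) j ≡ lookup Z i)
  ++-position []      y Z zero    = inj₁ (zero , refl , refl)
  ++-position []      y Z (suc j) = inj₂ (j , refl , refl)
  ++-position (p ∷ P) y Z zero    = inj₁ (zero , refl , refl)
  ++-position (p ∷ P) y Z (suc j) with ++-position P y Z j
  ... | inj₁ (i , t , e) = inj₁ (suc i , cong suc t , e)
  ... | inj₂ (i , t , e) = inj₂ (i , cong suc t , e)

  attaches-start-++ : ∀ {k m p y} (P : Vec Vertex k) (Z : Vec Vertex m)
                    → Attaches p (P ∷ʳ y) AtStart → Far p Z → Attaches p (P ++ (y ∷ Z)) AtStart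
  attaches-start-++ {p = p} {y} P Z att far = record { fresh = fresh ; adj⇒ = adj⇒ ; ⇒adj = ⇒adj }
    where
      module W = Attaches att
      fresh : ∀ j → p ≢ lookup (P ++ (y ∷ Z)) j
      fresh j e with ++-position P y Z j
      ... | inj₁ (i , t , e') = W.fresh i (trans e e')
      ... | inj₂ (i , t , e') = proj₁ (far i) (trans e e')
      adj⇒ : ∀ j → p ~ lookup (P ++ (y ∷ Z)) j → toℕ j ≡ 0
      adj⇒ j p~ with ++-position P y Z j
      ... | inj₁ (i , t , e') = trans (sym t) (W.adj⇒ i (~-resp refl e' p~))
      ... | inj₂ (i , t , e') = ⊥-elim (proj₂ (far i) (~-resp refl e' p~))
      ⇒adj : ∀ j → toℕ j ≡ 0 → p ~ lookup (P ++ (y ∷ Z)) j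
      ⇒adj j z with ++-position P y Z j
      ... | inj₁ (i , t , e') = ~-resp refl (sym e') (W.⇒adj i (trans t z))
      ... | inj₂ (i , t , e') = ⊥-elim (ℕ.1+n≢0 (trans (sym t) z))

  ++-induced : ∀ {k m y} (P : Vec Vertex k) {Z : Vec Vertex m}
             → InducedPath (P ∷ʳ y) → InducedPath (y ∷ Z) → Separated P Z → InducedPath (P ++ (y ∷ Z))
  ++-induced []      _   yZ _   = yZ
  ++-induced (p ∷ P) pPy yZ sep =
    ∷-induced (++-induced P Py yZ (λ i → sep (suc i))) (attaches-start-++ P _ att (sep zero))
    where
      Py  = proj₁ (∷-induced⁻ pPy)
      att = proj₂ (∷-induced⁻ pPy)

  close-cycle : ∀ {m w} {L : Vec Vertex m} → 2 ≤ m → InducedPath L → Attaches w L AtEnds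
              → InducedCycle (w ∷ L)
  close-cycle {m} {w} {L} (s≤s (s≤s z≤n)) ip att =
    record { length≥3 = s≤s (s≤s (s≤s z≤n)) ; distinct = dis ; adj⇒pos = ap ; pos⇒adj = pa }
    where
      module I = InducedPath ip
      module W = Attaches att
      dis : ∀ i j → lookup (w ∷ L) i ≡ lookup (w ∷ L) j → i ≡ j
      dis zero    zero    e = refl
      dis zero    (suc j) e = ⊥-elim (W.fresh j e)
      dis (suc i) zero    e = ⊥-elim (W.fresh i (sym e))
      dis (suc i) (suc j) e = cong suc (I.distinct i j e)
      ap : ∀ i j → lookup (w ∷ L) i ~ lookup (w ∷ L) j → CycAdj i j
      ap zero    zero    e = ⊥-elim (~-irr refl e)
      ap zero    (suc j) e with W.adj⇒ j e
      ... | inj₁ q = inj₁ (inj₁ (cong suc (sym q)))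
      ... | inj₂ q = inj₂ (inj₂ (cong suc q , refl))
      ap (suc i) zero    e with W.adj⇒ i (~-sym e)
      ... | inj₁ q = inj₁ (inj₂ (cong suc (sym q)))
      ... | inj₂ q = inj₂ (inj₁ (cong suc q , refl))
      ap (suc i) (suc j) e with I.adj⇒pos i j e
      ... | inj₁ q = inj₁ (inj₁ (cong suc q))
      ... | inj₂ q = inj₁ (inj₂ (cong suc q))
      pa : ∀ i j → CycAdj i j → lookup (w ∷ L) i ~ lookup (w ∷ L) j
      pa zero    zero    (inj₁ (inj₁ ()))
      pa zero    zero    (inj₁ (inj₂ ()))
      pa zero    zero    (inj₂ (inj₁ (() , _)))
      pa zero    zero    (inj₂ (inj₂ (() , _)))
      pa zero    (suc j) (inj₁ (inj₁ q))      = W.⇒adj j (inj₁ (sym (ℕ.suc-injective q)))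
      pa zero    (suc j) (inj₁ (inj₂ ()))
      pa zero    (suc j) (inj₂ (inj₁ (() , _)))
      pa zero    (suc j) (inj₂ (inj₂ (q , _))) = W.⇒adj j (inj₂ (ℕ.suc-injective q))
      pa (suc i) zero    (inj₁ (inj₁ ()))
      pa (suc i) zero    (inj₁ (inj₂ q))      = ~-sym (W.⇒adj i (inj₁ (sym (ℕ.suc-injective q))))
      pa (suc i) zero    (inj₂ (inj₁ (q , _))) = ~-sym (W.⇒adj i (inj₂ (ℕ.suc-injective q)))
      pa (suc i) zero    (inj₂ (inj₂ (() , _)))
      pa (suc i) (suc j) (inj₁ (inj₁ q))      = I.pos⇒adj i j (inj₁ (ℕ.suc-injective q))
      pa (suc i) (suc j) (inj₁ (inj₂ q))      = I.pos⇒adj i j (inj₂ (ℕ.suc-injective q))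
      pa (suc i) (suc j) (inj₂ (inj₁ (_ , ())))
      pa (suc i) (suc j) (inj₂ (inj₂ (_ , ())))

  beyond-prefix : ∀ k t → suc (suc (k + t)) ≡ k + suc (suc t)
  beyond-prefix k t = sym (trans (ℕ.+-suc k (suc t)) (cong suc (ℕ.+-suc k t)))

  attaches-ends-++ : ∀ {k m x y} (P : Vec Vertex k) (Z : Vec Vertex (suc m))
                   → Attaches x (P ∷ʳ y) AtStart → Attaches x (y ∷ Z) AtEnd
                   → Attaches x (P ++ (y ∷ Z)) AtEnds
  attaches-ends-++ {k} {m} {x} {y} P Z start end = record { fresh = fresh ; adj⇒ = adj⇒ ; ⇒adj = ⇒adj }
    where
      module S = Attaches start
      module E = Attaches end
      L = P ++ (y ∷ Z)
      last-of-Z : ∀ (i : Fin (suc m)) → suc (suc (k + toℕ i)) ≡ k + suc (suc m) → toℕ i ≡ m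
      last-of-Z i q = ℕ.+-cancelˡ-≡ k _ _
        (ℕ.suc-injective (ℕ.suc-injective (trans q (sym (beyond-prefix k m)))))
      not-last-of-L : ∀ (i : Fin (suc k)) → suc (toℕ i) ≢ k + suc (suc m)
      not-last-of-L i q = ℕ.n≮n (suc k) (begin
        suc (suc k)          ≤⟨ s≤s (s≤s (ℕ.m≤m+n k m)) ⟩
        suc (suc (k + m))    ≡⟨ beyond-prefix k m ⟩
        k + suc (suc m)      ≡⟨ sym q ⟩
        suc (toℕ i)          ≤⟨ toℕ<n i ⟩
        suc k                ∎)
        where open ℕ.≤-Reasoning
      fresh : ∀ j → x ≢ lookup L j
      fresh j e with ++-position P y Z j
      ... | inj₁ (i , t , e') = S.fresh i (trans e e')
      ... | inj₂ (i , t , e') = E.fresh (suc i) (trans e e')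
      adj⇒ : ∀ j → x ~ lookup L j → AtEnds j
      adj⇒ j x~ with ++-position P y Z j
      ... | inj₁ (i , t , e') = inj₁ (trans (sym t) (S.adj⇒ i (~-resp refl e' x~)))
      ... | inj₂ (i , t , e') = inj₂ (trans (cong suc t) (trans
              (cong (λ z → suc (suc (k + z)))
                    (ℕ.suc-injective (ℕ.suc-injective (E.adj⇒ (suc i) (~-resp refl e' x~)))))
              (beyond-prefix k m)))
      ⇒adj : ∀ j → AtEnds j → x ~ lookup L j
      ⇒adj j ends with ++-position P y Z j | ends
      ... | inj₁ (i , t , e') | inj₁ z = ~-resp refl (sym e') (S.⇒adj i (trans t z))
      ... | inj₂ (i , t , e') | inj₁ z = ⊥-elim (ℕ.1+n≢0 (trans (sym t) z))
      ... | inj₁ (i , t , e') | inj₂ q = ⊥-elim (not-last-of-L i (trans (cong suc t) q))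
      ... | inj₂ (i , t , e') | inj₂ q = ~-resp refl (sym e')
              (E.⇒adj (suc i) (cong (λ z → suc (suc z)) (last-of-Z i (trans (cong suc (sym t)) q))))

  glue-cycle : ∀ {k m x y} (P : Vec Vertex (suc k)) (Z : Vec Vertex m)
             → InducedPath (x ∷ (P ∷ʳ y)) → InducedPath (y ∷ Z) → Attaches x (y ∷ Z) AtEnd
             → Separated P Z → InducedCycle (x ∷ (P ++ (y ∷ Z)))
  glue-cycle P []      xPy yZ end sep =
    ⊥-elim (proj₂ (extension-ends-apart {P = P} xPy) (Attaches.⇒adj end zero refl))
  glue-cycle {k} {suc m} P (z ∷ Z) xPy yZ end sep =
    close-cycle two (++-induced P Py yZ sep) (attaches-ends-++ P (z ∷ Z) start end)
    where
      Py    = proj₁ (∷-induced⁻ xPy)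
      start = proj₂ (∷-induced⁻ xPy)
      two : 2 ≤ suc k + suc (suc m)
      two = s≤s (ℕ.≤-trans (s≤s z≤n) (ℕ.m≤n+m (suc (suc m)) k))

  glued-contains : ∀ {k m} x (P : Vec Vertex k) y (Z : Vec Vertex m)
                 → CycleContains (x ∷ (P ++ (y ∷ Z))) (x ∷ (P ∷ʳ y))
  glued-contains x P y Z zero    = here refl
  glued-contains x P y Z (suc i) = there (prefix P i)
    where
      prefix : ∀ {k} (P : Vec Vertex k) i → lookup (P ∷ʳ y) i ∈ᵥ (P ++ (y ∷ Z))
      prefix []      zero    = here refl
      prefix (p ∷ P) zero    = here refl
      prefix (p ∷ P) (suc i) = there (prefix P i)

module ShortestPaths (G : Graph) where
  open Graph G
  open PathAlgebra G

  -- a walk from a to b all of whose vertices, except possibly b, lie in T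
  data Walk (T : Subset n) : Vertex → Vertex → Set where
    end  : ∀ {b} → Walk T b b
    step : ∀ {a c b} → a ∈ T → a ~ c → Walk T c b → Walk T a b

  module _ {T : Subset n} where

    vertices : ∀ {a b} → Walk T a b → List Vertex
    vertices {b = b} end = b ∷ []
    vertices (step {a} _ _ W) = a ∷ vertices W

    first∈ : ∀ {a b} (W : Walk T a b) → a ∈ˡ vertices W
    first∈ end          = here refl
    first∈ (step _ _ W) = here refl

    last∈ : ∀ {a b} (W : Walk T a b) → b ∈ˡ vertices W
    last∈ end          = here refl
    last∈ (step _ _ W) = there (last∈ W)

    vertices-in : ∀ {a b z} (W : Walk T a b) → z ∈ˡ vertices W → z ∈ T ⊎ z ≡ b
    vertices-in end          (here refl) = inj₂ refl
    vertices-in (step t _ W) (here refl) = inj₁ t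
    vertices-in (step t _ W) (there z∈) = vertices-in W z∈

    _▸_ : ∀ {a b c} → Walk T a b → Walk T b c → Walk T a c
    end          ▸ W' = W'
    step t a~ W  ▸ W' = step t a~ (W ▸ W')

    weaken : ∀ {T'} → T ⊆ T' → ∀ {a b} → Walk T a b → Walk T' a b
    weaken T⊆T' end          = end
    weaken T⊆T' (step t a~ W) = step (T⊆T' t) a~ (weaken T⊆T' W)

  -- an induced path s ∷ body whose body runs through T along vertices of vs, and to which e
  -- attaches exactly at the far end; so s ∷ body ∷ʳ e is an induced path from s to e via T
  record InducedPathTo (T : Subset n) (s e : Vertex) (vs : List Vertex) : Set where
    field
      len      : ℕ
      body     : Vec Vertex len
      induced  : InducedPath (s ∷ body)
      attached : Attaches e (s ∷ body) AtEnd
      through  : Every (_∈ T) body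
      along    : Every (_∈ˡ vs) body

  edge-to : ∀ {T s e} → s ~ e → e ≢ s → InducedPathTo T s e (e ∷ [])
  edge-to s~e e≢s = record
    { len = 0 ; body = []
    ; induced  = ∷-induced []-induced (record { fresh = λ () ; adj⇒ = λ () ; ⇒adj = λ () })
    ; attached = record { fresh = λ { zero → e≢s } ; adj⇒ = λ { zero _ → refl }
                        ; ⇒adj = λ { zero _ → ~-sym s~e } }
    ; through = λ () ; along = λ () }

  prepend : ∀ {T s a e vs} → a ∈ T → s ~ a → s ≢ a → (∀ {z} → z ∈ˡ vs → Apart s z) → e ∈ˡ vs
          → InducedPathTo T a e vs → InducedPathTo T s e (a ∷ vs)
  prepend {T} {s} {a} {e} {vs} a∈T s~a s≢a far e∈ r = record
    { len = suc len ; body = a ∷ body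
    ; induced  = ∷-induced induced (record
        { fresh = λ { zero → s≢a ; (suc j) → proj₁ (far (along j)) }
        ; adj⇒  = λ { zero _ → refl ; (suc j) s~ → ⊥-elim (proj₂ (far (along j)) s~) }
        ; ⇒adj  = λ { zero _ → s~a ; (suc j) () } })
    ; attached = record
        { fresh = λ { zero e≡s → proj₁ (far e∈) (sym e≡s) ; (suc j) → A.fresh j }
        ; adj⇒  = λ { zero e~s → ⊥-elim (proj₂ (far e∈) (~-sym e~s))
                    ; (suc j) e~ → cong-suc (A.adj⇒ j e~) }
        ; ⇒adj  = λ { zero q → ⊥-elim (ℕ.1+n≢0 (sym (ℕ.suc-injective q)))
                    ; (suc j) q → A.⇒adj j (ℕ.suc-injective q) } }
    ; through = every-∷ {Q = _∈ T} a∈T through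
    ; along = every-∷ {Q = _∈ˡ a ∷ vs} (here refl) (λ j → there (along j)) }
    where
      open InducedPathTo r
      module A = Attaches attached
      cong-suc : ∀ {m n : ℕ} → m ≡ n → suc m ≡ suc n
      cong-suc refl = refl

  widen : ∀ {T s e a vs} → InducedPathTo T s e vs → InducedPathTo T s e (a ∷ vs)
  widen r = record { len = len ; body = body ; induced = induced ; attached = attached
                   ; through = through ; along = λ j → there (along j) }
    where open InducedPathTo r

  shortcut : ∀ {T a e} s (W : Walk T a e) → Any (s ~_) (vertices W) → s ∉ˡ vertices W
           → InducedPathTo T s e (vertices W)
  shortcut s end (here s~e) s∉ = edge-to s~e (λ e≡s → s∉ (here (sym e≡s)))
  shortcut s (step a∈T a~c W) adj s∉ with any? (~-dec s) (vertices W)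
  ... | yes adjW = widen (shortcut s W adjW (λ s∈ → s∉ (there s∈)))
  ... | no ¬adjW =
    prepend a∈T s~a (λ s≡a → s∉ (here s≡a)) far (last∈ W)
      (shortcut _ W (lose (first∈ W) a~c) (λ a∈ → ¬adjW (lose a∈ s~a)))
    where
      only-first : Any (s ~_) (vertices (step a∈T a~c W)) → s ~ _
      only-first (here p)  = p
      only-first (there p) = ⊥-elim (¬adjW p)
      s~a = only-first adj
      far : ∀ {z} → z ∈ˡ vertices W → Apart s z
      far z∈ = (λ s≡z → s∉ (there (subst (_∈ˡ vertices W) (sym s≡z) z∈)))
             , (λ s~z → ¬adjW (lose z∈ s~z))

∈─⇒∉ : ∀ {m} (p q : Subset m) {x : Fin m} → x ∈ p ─ q → x ∉ q
∈─⇒∉ (_ ∷ p) (outside ∷ q) here      ()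
∈─⇒∉ (_ ∷ p) (_ ∷ q)       (there h) (there h') = ∈─⇒∉ p q h h'

module Neighbourhoods (G : Graph) where
  open Graph G
  open PathAlgebra G
  open ShortestPaths G

  Adjacent : Subset n → Vertex → Set
  Adjacent A u = Σ Vertex λ a → a ∈ A × a ~ u

  Near : Subset n → Vertex → Set
  Near A u = u ∈ A ⊎ Adjacent A u

  adjacent? : ∀ A u → Dec (Adjacent A u)
  adjacent? A u = Fin.any? (λ a → (a ∈? A) ×-dec ~-dec a u)

  near? : ∀ A u → Dec (Near A u)
  near? A u = (u ∈? A) ⊎-dec adjacent? A u

  N[_] : Subset n → Subset n
  N[ A ] = tabulate (λ u → isYes (near? A u))

  ∈N[]⁺ : ∀ {A u} → Near A u → u ∈ N[ A ]
  ∈N[]⁺ {A} {u} near =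
    lookup⇒[]= u N[ A ] (trans (lookup∘tabulate _ u) (Equivalence.to T-≡ (fromWitness near)))

  ∈N[]⁻ : ∀ {A u} → u ∈ N[ A ] → Near A u
  ∈N[]⁻ {A} {u} h =
    toWitness (Equivalence.from T-≡ (trans (sym (lookup∘tabulate _ u)) ([]=⇒lookup h)))

  ∉N[] : ∀ {S A u} → u ∈ S ─ N[ A ] → ¬ Near A u
  ∉N[] {S} {A} h = ∈─⇒∉ S N[ A ] h ∘ ∈N[]⁺

  near-∪⁻ : ∀ {A B z} → Near (A ∪ B) z → Near A z ⊎ Near B z
  near-∪⁻ {A} {B} (inj₁ z∈) = [ inj₁ ∘ inj₁ , inj₂ ∘ inj₁ ] (x∈p∪q⁻ A B z∈)
  near-∪⁻ {A} {B} (inj₂ (b , b∈ , b~z)) =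
    [ (λ b∈A → inj₁ (inj₂ (b , b∈A , b~z))) , (λ b∈B → inj₂ (inj₂ (b , b∈B , b~z))) ]
      (x∈p∪q⁻ A B b∈)

  near-∪ˡ : ∀ {A B z} → Near A z → Near (A ∪ B) z
  near-∪ˡ (inj₁ z∈)              = inj₁ (x∈p∪q⁺ (inj₁ z∈))
  near-∪ˡ (inj₂ (a , a∈ , a~z)) = inj₂ (a , x∈p∪q⁺ (inj₁ a∈) , a~z)

  apart⇒∉N[⁅⁆] : ∀ {v z} → Apart v z → ¬ Near ⁅ v ⁆ z
  apart⇒∉N[⁅⁆] {v} (v≢z , _)   (inj₁ z∈)              = v≢z (sym (x∈⁅y⁆⇒x≡y v z∈))
  apart⇒∉N[⁅⁆] {v} (_ , ¬v~z) (inj₂ (b , b∈ , b~z)) = ¬v~z (subst (_~ _) (x∈⁅y⁆⇒x≡y v b∈) b~z)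

  ∉N[⁅⁆]⇒apart : ∀ {v z} → ¬ Near ⁅ v ⁆ z → Apart v z
  ∉N[⁅⁆]⇒apart {v} far =
    (λ { refl → far (inj₁ (x∈⁅x⁆ v)) }) , (λ v~z → far (inj₂ (v , x∈⁅x⁆ v , v~z)))

  ∉N[∪⁅⁆] : ∀ {A v z} → ¬ Near A z → Apart v z → ¬ Near (A ∪ ⁅ v ⁆) z
  ∉N[∪⁅⁆] ¬near apart = [ ¬near , apart⇒∉N[⁅⁆] apart ] ∘ near-∪⁻

  Connected : Subset n → Set
  Connected A = ∀ {a b} → a ∈ A → b ∈ A → Walk A a b

  ⁅⁆-connected : ∀ v → Connected ⁅ v ⁆
  ⁅⁆-connected v a∈ b∈ with x∈⁅y⁆⇒x≡y v a∈ | x∈⁅y⁆⇒x≡y v b∈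
  ... | refl | refl = end

  ∪⁅⁆-connected : ∀ {A a v} → Connected A → a ∈ A → a ~ v → Connected (A ∪ ⁅ v ⁆)
  ∪⁅⁆-connected {A} {a} {v} conn a∈A a~v {b} {c} b∈ c∈
    with x∈p∪q⁻ A ⁅ v ⁆ b∈ | x∈p∪q⁻ A ⁅ v ⁆ c∈
  ... | inj₁ b∈A | inj₁ c∈A = weaken (p⊆p∪q _) (conn b∈A c∈A)
  ... | inj₁ b∈A | inj₂ c∈v with x∈⁅y⁆⇒x≡y v c∈v
  ...   | refl = weaken (p⊆p∪q _) (conn b∈A a∈A) ▸ step (p⊆p∪q _ a∈A) a~v end
  ∪⁅⁆-connected {A} {a} {v} conn a∈A a~v {b} {c} b∈ c∈ | inj₂ b∈v | inj₁ c∈A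
    with x∈⁅y⁆⇒x≡y v b∈v
  ...   | refl = step (x∈p∪q⁺ (inj₂ (x∈⁅x⁆ _))) (~-sym a~v) (weaken (p⊆p∪q _) (conn a∈A c∈A))
  ∪⁅⁆-connected {A} {a} {v} conn a∈A a~v {b} {c} b∈ c∈ | inj₂ b∈v | inj₂ c∈v
    with x∈⁅y⁆⇒x≡y v b∈v | x∈⁅y⁆⇒x≡y v c∈v
  ...   | refl | refl = end

  measure : Subset n → Subset n → ℕ
  measure S A = ∣ S ∣ + ∣ S ─ A ∣

  -- removing a vertex of S from S, adding a vertex of S ∖ A to A, or removing N[A] from S
  -- (for non-empty A ⊆ S) strictly decreases the measure
  ∣─⁅⁆∣< : ∀ {S : Subset n} {x} → x ∈ S → ∣ S ─ ⁅ x ⁆ ∣ < ∣ S ∣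
  ∣─⁅⁆∣< {S} {x} x∈S = p∩q≢∅⇒∣p─q∣<∣p∣ S ⁅ x ⁆ (x , x∈p∩q⁺ (x∈S , x∈⁅x⁆ x))

  measure-⁅⁆ : ∀ {S : Subset n} {x} → x ∈ S → measure S ⁅ x ⁆ < ∣ S ∣ + ∣ S ∣
  measure-⁅⁆ {S} x∈S = ℕ.+-monoʳ-< ∣ S ∣ (∣─⁅⁆∣< x∈S)

  measure-∪⁅⁆ : ∀ {S A : Subset n} {v} → v ∈ S → v ∉ A → measure S (A ∪ ⁅ v ⁆) < measure S A
  measure-∪⁅⁆ {S} {A} {v} v∈S v∉A = ℕ.+-monoʳ-< ∣ S ∣
    (subst (_< ∣ S ─ A ∣) (cong ∣_∣ (p─q─r≡p─q∪r S A ⁅ v ⁆)) (∣─⁅⁆∣< (x∈p∧x∉q⇒x∈p─q v∈S v∉A)))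

  measure-─N[] : ∀ {S A : Subset n} {r} → r ∈ S → r ∈ A
               → ∣ S ─ N[ A ] ∣ + ∣ S ─ N[ A ] ∣ < measure S A
  measure-─N[] {S} {A} {r} r∈S r∈A = ℕ.+-mono-<-≤
    (p∩q≢∅⇒∣p─q∣<∣p∣ S N[ A ] (r , x∈p∩q⁺ (r∈S , ∈N[]⁺ (inj₁ r∈A))))
    (p⊆q⇒∣p∣≤∣q∣ (λ h → x∈p∧x∉q⇒x∈p─q (p─q⊆p S N[ A ] h) (λ x∈A → ∉N[] {S} h (inj₁ x∈A))))

  ⁅⁆⊆ : ∀ {S : Subset n} {v} → v ∈ S → ⁅ v ⁆ ⊆ S
  ⁅⁆⊆ {S} {v} v∈S h = subst (_∈ S) (sym (x∈⁅y⁆⇒x≡y v h)) v∈S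

  ∪⁅⁆⊆ : ∀ {S A : Subset n} {v} → A ⊆ S → v ∈ S → A ∪ ⁅ v ⁆ ⊆ S
  ∪⁅⁆⊆ {S} {A} {v} A⊆S v∈S h = [ A⊆S , ⁅⁆⊆ v∈S ] (x∈p∪q⁻ A ⁅ v ⁆ h)

module Avoidance (G : Graph) (k' : ℕ) where
  open Graph G
  open PathAlgebra G
  open ShortestPaths G
  open Neighbourhoods G

  k : ℕ
  k = suc k'

  Within : Subset n → ∀ {m} → Vec Vertex m → Set
  Within S = Every (_∈ S)

  Outside : Subset n → ∀ {m} → Vec Vertex m → Set
  Outside A = Every (¬_ ∘ Near A)

  CycleIn : Subset n → ∀ {m} → Vec Vertex m → Set
  CycleIn S Q = Σ ℕ λ m → Σ (Vec Vertex m) λ C → InducedCycle C × CycleContains C Q × Within S C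

  AvoidableIn : Subset n → Vec Vertex k → Set
  AvoidableIn S P = ∀ {x y} → x ∈ S → y ∈ S → InducedPath (x ∷ (P ∷ʳ y)) → CycleIn S (x ∷ (P ∷ʳ y))

  ExtensionIn : Subset n → Vec Vertex k → Set
  ExtensionIn S P = Σ Vertex λ x → Σ Vertex λ y → x ∈ S × y ∈ S × InducedPath (x ∷ (P ∷ʳ y))

  PathIn : Subset n → Set
  PathIn S = Σ (Vec Vertex k) λ P → InducedPath P × Within S P

  PathBeyond : Subset n → Subset n → Set
  PathBeyond S A = Σ (Vec Vertex k) λ P → InducedPath P × Within S P × Outside A P

  AvoidablePathIn : Subset n → Set
  AvoidablePathIn S = Σ (Vec Vertex k) λ P → InducedPath P × Within S P × AvoidableIn S P

  AvoidablePathBeyond : Subset n → Subset n → Set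
  AvoidablePathBeyond S A =
    Σ (Vec Vertex k) λ P → InducedPath P × Within S P × Outside A P × AvoidableIn S P

  Growable : Subset n → Subset n → Set
  Growable S A = Σ Vertex λ v → v ∈ S × v ∉ A × Adjacent A v × PathBeyond S (A ∪ ⁅ v ⁆)

  induced? : ∀ {m} (P : Vec Vertex m) → Dec (InducedPath P)
  induced? P = map′ (λ (d , a , p) → record { distinct = d ; adj⇒pos = a ; pos⇒adj = p })
                    (λ ip → InducedPath.distinct ip , InducedPath.adj⇒pos ip , InducedPath.pos⇒adj ip)
    (Fin.all? (λ i → Fin.all? (λ j → (lookup P i Fin.≟ lookup P j) →-dec (i Fin.≟ j)))
     ×-dec Fin.all? (λ i → Fin.all? (λ j → ~-dec (lookup P i) (lookup P j) →-dec pathAdj? i j))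
     ×-dec Fin.all? (λ i → Fin.all? (λ j → pathAdj? i j →-dec ~-dec (lookup P i) (lookup P j))))
    where
      pathAdj? : ∀ {m} (i j : Fin m) → Dec (PathAdj i j)
      pathAdj? i j = (suc (toℕ i) ℕ.≟ toℕ j) ⊎-dec (suc (toℕ j) ℕ.≟ toℕ i)

  within? : ∀ S {m} (P : Vec Vertex m) → Dec (Within S P)
  within? S P = Fin.all? (λ i → lookup P i ∈? S)

  outside? : ∀ A {m} (P : Vec Vertex m) → Dec (Outside A P)
  outside? A P = Fin.all? (λ i → ¬? (near? A (lookup P i)))

  some-vector? : ∀ m {Q : Vec Vertex m → Set} → (∀ P → Dec (Q P)) → Dec (Σ (Vec Vertex m) Q)
  some-vector? zero    Q? = map′ ([] ,_) (λ { ([] , q) → q }) (Q? [])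
  some-vector? (suc m) Q? = map′ (λ (x , P , q) → x ∷ P , q) (λ { (x ∷ P , q) → x , P , q })
                                 (Fin.any? (λ x → some-vector? m (λ P → Q? (x ∷ P))))

  pathBeyond? : ∀ S A → Dec (PathBeyond S A)
  pathBeyond? S A = some-vector? k (λ P → induced? P ×-dec within? S P ×-dec outside? A P)

  growable? : ∀ S A → Dec (Growable S A)
  growable? S A = Fin.any? (λ v → (v ∈? S) ×-dec ¬? (v ∈? A) ×-dec adjacent? A v
                                  ×-dec pathBeyond? S (A ∪ ⁅ v ⁆))

  outsideClosedNbhd? : ∀ u (P : Vec Vertex k) → Dec (OutsideClosedNbhd u P)
  outsideClosedNbhd? u P = Fin.all? (λ i → ¬? (lookup P i Fin.≟ u) ×-dec ¬? (~-dec u (lookup P i)))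

  extensionIn? : ∀ S P → Dec (ExtensionIn S P)
  extensionIn? S P =
    Fin.any? (λ x → Fin.any? (λ y → (x ∈? S) ×-dec (y ∈? S) ×-dec induced? (x ∷ (P ∷ʳ y))))

  extension-ends-∉ : ∀ {A x y} (P : Vec Vertex k) → Outside A P → InducedPath (x ∷ (P ∷ʳ y))
                   → x ∉ A × y ∉ A
  extension-ends-∉ {A} {x} {y} (p ∷ P₁) out ext =
      (λ x∈A → out zero (inj₂ (x , x∈A , InducedPath.pos⇒adj ext zero (suc zero) (inj₁ refl))))
    , (λ y∈A → out (fromℕ k') (inj₂ (y , y∈A , y~last)))
    where
      y~last : y ~ lookup (p ∷ P₁) (fromℕ k')
      y~last = Attaches.⇒adj (proj₂ (∷ʳ-induced⁻ {L = x ∷ p ∷ P₁} ext)) (suc (fromℕ k'))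
                 (cong (λ t → suc (suc t)) (toℕ-fromℕ k'))

  grow-at-start : ∀ {S A x y} (P : Vec Vertex k) → Within S P → Outside A P → x ∈ S → y ∈ S
                → x ∉ A → Adjacent A x → ¬ Near A y → InducedPath (x ∷ (P ∷ʳ y)) → Growable S A
  grow-at-start {S} {A} {x} {y} (p ∷ P₁) inS out x∈S y∈S x∉A x~A y-far ext =
    x , x∈S , x∉A , x~A , P₁ ∷ʳ y , proj₁ shifted , every-∷ʳ {Q = _∈ S} P₁ (inS ∘ suc) y∈S , beyond
    where
      shifted = drop-first ext
      beyond : Outside (A ∪ ⁅ x ⁆) (P₁ ∷ʳ y)
      beyond i = ∉N[∪⁅⁆] (every-∷ʳ {Q = ¬_ ∘ Near A} P₁ (out ∘ suc) y-far i) (proj₂ shifted i)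

  grow-at-end : ∀ {S A x y} (P : Vec Vertex k) → Within S P → Outside A P → x ∈ S → y ∈ S
              → y ∉ A → Adjacent A y → ¬ Near A x → InducedPath (x ∷ (P ∷ʳ y)) → Growable S A
  grow-at-end {S} {A} {x} {y} P inS out x∈S y∈S y∉A y~A x-far ext with initLast P
  ... | P₀ , p , refl =
    y , y∈S , y∉A , y~A , x ∷ P₀ , proj₁ shifted ,
    every-∷ {Q = _∈ S} x∈S (every-init {Q = _∈ S} P₀ inS) , beyond
    where
      shifted = drop-last ext
      beyond : Outside (A ∪ ⁅ y ⁆) (x ∷ P₀)
      beyond i = ∉N[∪⁅⁆] (every-∷ {Q = ¬_ ∘ Near A} x-far (every-init {Q = ¬_ ∘ Near A} P₀ out) i)
                         (proj₂ shifted i)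

  -- x and y both adjacent to the connected set A: a shortest path from y to x through A closes
  -- the extension x P y into an induced cycle of G[S]
  cycle-through : ∀ {S A x y} → A ⊆ S → Connected A → (P : Vec Vertex k) → Within S P → Outside A P
                → x ∈ S → y ∈ S → y ∉ A → Adjacent A x → Adjacent A y
                → InducedPath (x ∷ (P ∷ʳ y)) → CycleIn S (x ∷ (P ∷ʳ y))
  cycle-through {S} {A} {x} {y} A⊆S conn P inS out x∈S y∈S y∉A
                (a₁ , a₁∈A , a₁~x) (a₂ , a₂∈A , a₂~y) ext =
    _ , x ∷ (P ++ (y ∷ body)) , glue-cycle P body ext induced attached separated ,
    glued-contains x P y body ,
    every-∷ {Q = _∈ S} x∈S (every-++ {Q = _∈ S} P inS (every-∷ {Q = _∈ S} y∈S (A⊆S ∘ through)))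
    where
      W : Walk A a₂ x
      W = conn a₂∈A a₁∈A ▸ step a₁∈A a₁~x end
      y∉W : y ∉ˡ vertices W
      y∉W y∈W =
        [ y∉A , (λ y≡x → proj₁ (extension-ends-apart {P = P} ext) (sym y≡x)) ] (vertices-in W y∈W)
      open InducedPathTo (shortcut y W (lose (first∈ W) (~-sym a₂~y)) y∉W)
      separated : Separated P body
      separated i j = (λ p≡z → out i (inj₁ (subst (_∈ A) (sym p≡z) (through j))))
                    , (λ p~z → out i (inj₂ (_ , through j , ~-sym p~z)))

  lift-avoidable : ∀ {S A} → A ⊆ S → Connected A → ¬ Growable S A
                 → (P : Vec Vertex k) → Within S P → Outside A P
                 → AvoidableIn (S ─ N[ A ]) P → AvoidableIn S P
  lift-avoidable {S} {A} A⊆S conn ¬grow P inS out av {x} {y} x∈S y∈S ext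
    with extension-ends-∉ P out ext | adjacent? A x | adjacent? A y
  ... | x∉A , y∉A | no x-far | no y-far =
    let (m , C , cycle , contains , inS─N) = av (into x∉A x-far x∈S) (into y∉A y-far y∈S) ext
    in m , C , cycle , contains , p─q⊆p S N[ A ] ∘ inS─N
    where
      into : ∀ {z} → z ∉ A → ¬ Adjacent A z → z ∈ S → z ∈ S ─ N[ A ]
      into z∉A z-far z∈S = x∈p∧x∉q⇒x∈p─q z∈S ([ z∉A , z-far ] ∘ ∈N[]⁻)
  ... | x∉A , y∉A | yes x~A | no y-far =
    ⊥-elim (¬grow (grow-at-start P inS out x∈S y∈S x∉A x~A [ y∉A , y-far ] ext))
  ... | x∉A , y∉A | no x-far | yes y~A =
    ⊥-elim (¬grow (grow-at-end P inS out x∈S y∈S y∉A y~A [ x∉A , x-far ] ext))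
  ... | x∉A , y∉A | yes x~A | yes y~A = cycle-through A⊆S conn P inS out x∈S y∈S y∉A x~A y~A ext

  avoidable-in : ∀ b S → ∣ S ∣ + ∣ S ∣ < b → PathIn S → AvoidablePathIn S
  avoidable-beyond : ∀ b {S A r} → r ∈ A → A ⊆ S → Connected A → measure S A < b
                   → PathBeyond S A → AvoidablePathBeyond S A

  avoidable-in (suc b) S bound (P@(p ∷ P₁) , ip , inS) with extensionIn? S P
  ... | no ¬ext = P , ip , inS , λ x∈S y∈S ext → ⊥-elim (¬ext (_ , _ , x∈S , y∈S , ext))
  ... | yes (x , y , x∈S , y∈S , ext) =
    let (P' , ip' , inS' , _ , av') = avoidable-beyond b (x∈⁅x⁆ x) (⁅⁆⊆ x∈S) (⁅⁆-connected x)
          (ℕ.<-≤-trans (measure-⁅⁆ x∈S) (ℕ.≤-pred bound))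
          (P₁ ∷ʳ y , proj₁ (drop-first ext) , every-∷ʳ {Q = _∈ S} P₁ (inS ∘ suc) y∈S ,
           apart⇒∉N[⁅⁆] ∘ proj₂ (drop-first ext))
    in P' , ip' , inS' , av'

  avoidable-beyond (suc b) {S} {A} r∈A A⊆S conn bound (P , ip , inS , out) with growable? S A
  ... | yes (v , v∈S , v∉A , (a , a∈A , a~v) , beyond) =
    let (P' , ip' , inS' , out' , av') = avoidable-beyond b (x∈p∪q⁺ (inj₁ r∈A)) (∪⁅⁆⊆ A⊆S v∈S)
          (∪⁅⁆-connected conn a∈A a~v) (ℕ.<-≤-trans (measure-∪⁅⁆ v∈S v∉A) (ℕ.≤-pred bound)) beyond
    in P' , ip' , inS' , (λ i → out' i ∘ near-∪ˡ) , av'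
  ... | no ¬grow =
    let (P' , ip' , inS─N , av') = avoidable-in b (S ─ N[ A ])
          (ℕ.<-≤-trans (measure-─N[] (A⊆S r∈A) r∈A) (ℕ.≤-pred bound))
          (P , ip , λ i → x∈p∧x∉q⇒x∈p─q (inS i) (out i ∘ ∈N[]⁻))
        inS' = p─q⊆p S N[ A ] ∘ inS─N
        out' = λ i → ∉N[] {S} (inS─N i)
    in P' , ip' , inS' , out' , lift-avoidable A⊆S conn ¬grow P' inS' out' av'

  avoidable-in-G : ∀ {P} → InducedPath P → AvoidableIn ⊤ P → Avoidable P
  avoidable-in-G ip av = ip , λ x y ext failing →
    let (m , C , cycle , contains , _) = av ∈⊤ ∈⊤ ext in failing (m , C , cycle , contains)

  avoidable-path : (Σ (Vec Vertex k) InducedPath) → Σ (Vec Vertex k) λ P → InducedPath P × Avoidable P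
  avoidable-path (P , ip) =
    let (P' , ip' , _ , av) = avoidable-in _ ⊤ (ℕ.n<1+n _) (P , ip , λ _ → ∈⊤)
    in P' , ip' , avoidable-in-G ip' av

  avoidable-path-outside : ∀ u → (Σ (Vec Vertex k) λ P → InducedPath P × OutsideClosedNbhd u P)
                         → Σ (Vec Vertex k) λ P → InducedPath P × OutsideClosedNbhd u P × Avoidable P
  avoidable-path-outside u (P , ip , ocn) =
    let (P' , ip' , _ , out' , av) = avoidable-beyond _ (x∈⁅x⁆ u) (λ _ → ∈⊤) (⁅⁆-connected u) (ℕ.n<1+n _)
                                       (P , ip , (λ _ → ∈⊤) , λ i → apart⇒∉N[⁅⁆] (flip (ocn i)))
    in P' , ip' , (λ i → flip (∉N[⁅⁆]⇒apart (out' i))) , avoidable-in-G ip' av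
    where
      flip : ∀ {a b} {C : Set} → a ≢ b × C → b ≢ a × C
      flip (a≢b , c) = (λ b≡a → a≢b (sym b≡a)) , c

either : ∀ {A B : Set} → Dec A → (A → B) → ¬ A ⊎ B
either (yes a) f = inj₂ (f a)
either (no ¬a) f = inj₁ ¬a

theorem2p4 : (k : ℕ) → 1 ≤ k → (G : Graph) → let open Graph G in
    ((¬ (Σ (Vec Vertex k) λ P → InducedPath P))
    ⊎ (Σ (Vec Vertex k) λ P → InducedPath P × Avoidable P))
    × ((u : Vertex) →
    (¬ (Σ (Vec Vertex k) λ P → InducedPath P × OutsideClosedNbhd u P))
    ⊎ (Σ (Vec Vertex k) λ P → InducedPath P × OutsideClosedNbhd u P × Avoidable P))
theorem2p4 zero    () G
theorem2p4 (suc k') _ G =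
    either (some-vector? _ induced?) avoidable-path
  , λ u → either (some-vector? _ (λ P → induced? P ×-dec outsideClosedNbhd? u P))
                 (avoidable-path-outside u)
  where
    open Avoidance G k'
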